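{- Let $k\ge1$. For every incidence graph $I$ of entangled hypertree width at most $k$ there exist an ehd $D=(T,\mathrm{bag},\mathrm{cover})$ of $I$ and a node $\omega\in V(T)$ with $|\mathrm{cover}(\omega)|\le k$ such that the tree $T$ rooted at $\omega$ is binary (every node has at most two children) and monotone (for every parent $t_p$ with child $t_c$, $|\mathrm{cover}(t_p)|\ge|\mathrm{cover}(t_c)|$).
   Context: An incidence graph $I=(R(I),B(I),E(I))$ has disjoint finite sets of red and blue nodes and $E(I)\subseteq B(I)\times R(I)$, each red node adjacent to some blue node; $N_I(x)$ is the neighbourhood. An entangled hypertree decomposition (ehd) of $I$ is $(T,\mathrm{bag},\mathrm{cover})$ with $T$ a finite tree, $\mathrm{bag}(t)\subseteq R(I)$, $\mathrm{cover}(t)\subseteq B(I)$, such that: every $e\in B(I)$ has a $t$ with $N_I(e)\subseteq\mathrm{bag}(t)$ and $e\in\mathrm{cover}(t)$; for each $v\in R(I)$ the nodes $t$ with $v\in\mathrm{bag}(t)$ form a connected subtree; for each $e\in B(I)$ the nodes $t$ with $e\in\mathrm{cover}(t)$ form a connected subtree; and $\mathrm{bag}(t)=\bigcup_{e\in\mathrm{cover}(t)}N_I(e)$ for all $t$. Width $=\max_t|\mathrm{cover}(t)|$; entangled hypertree width = minimum width of an ehd. -}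

module Defs where

open import Data.Nat using (ℕ; suc; _≤_)
open import Data.Fin using (Fin)
open import Data.Fin.Subset using (Subset; _∈_; ∣_∣)
open import Data.Bool using (Bool; true)
open import Data.Maybe using (Maybe; just; nothing)
open import Data.Product using (Σ; _×_; ∃; ∃-syntax)
open import Data.Sum using (_⊎_)
open import Function.Bundles using (_⇔_)
open import Relation.Binary.PropositionalEquality using (_≡_)

-- Incidence graph: red nodes Fin nR, blue nodes Fin nB,
-- E(I) ⊆ B(I) × R(I) given by a Boolean adjacency matrix.
record IncGraph : Set where
  field
    nR nB : ℕ
    adj : Fin nB → Fin nR → Bool
    redCovered : ∀ (v : Fin nR) → ∃[ e ] adj e v ≡ true

N : (I : IncGraph) → Fin (IncGraph.nB I) → Fin (IncGraph.nR I) → Set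
N I e v = IncGraph.adj I e v ≡ true

-- A finite (nonempty) tree on node set Fin n, presented via a root and
-- parent pointers; the depth function guarantees acyclicity and that
-- every node reaches the root.
record Tree : Set where
  field
    n      : ℕ
    root   : Fin n
    parent : Fin n → Maybe (Fin n)
    depth  : Fin n → ℕ
    root-parent : parent root ≡ nothing
    no-parent⇒root : ∀ t → parent t ≡ nothing → t ≡ root
    depth-parent : ∀ t p → parent t ≡ just p → depth t ≡ suc (depth p)

module _ (T : Tree) where
  open Tree T

  Edge : Fin n → Fin n → Set
  Edge t u = (parent t ≡ just u) ⊎ (parent u ≡ just t)

  data WalkIn (S : Fin n → Set) : Fin n → Fin n → Set where
    here : ∀ {t} → S t → WalkIn S t t
    step : ∀ {t u v} → S t → Edge t u → WalkIn S u v → WalkIn S t v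

  Connected : (Fin n → Set) → Set
  Connected S = ∀ t u → S t → S u → WalkIn S t u

record EHD (I : IncGraph) : Set where
  open IncGraph I
  field
    tree  : Tree
  open Tree tree
  field
    bag   : Fin n → Subset nR
    cover : Fin n → Subset nB
    covers : ∀ (e : Fin nB) → ∃[ t ] ((∀ v → N I e v → v ∈ bag t) × e ∈ cover t)
    bagConnected : ∀ (v : Fin nR) → Connected tree (λ t → v ∈ bag t)
    coverConnected : ∀ (e : Fin nB) → Connected tree (λ t → e ∈ cover t)
    bagIsUnion : ∀ t (v : Fin nR) → (v ∈ bag t) ⇔ (∃[ e ] (e ∈ cover t × N I e v))

WidthAtMost : {I : IncGraph} → EHD I → ℕ → Set
WidthAtMost D k = ∀ t → ∣ EHD.cover D t ∣ ≤ k

EhwAtMost : IncGraph → ℕ → Set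
EhwAtMost I k = Σ (EHD I) (λ D → WidthAtMost D k)

Binary : Tree → Set
Binary T = ∀ t c₁ c₂ c₃ → parent c₁ ≡ just t → parent c₂ ≡ just t → parent c₃ ≡ just t
           → (c₁ ≡ c₂) ⊎ (c₁ ≡ c₃) ⊎ (c₂ ≡ c₃)
  where open Tree T

Monotone : {I : IncGraph} → EHD I → Set
Monotone D = ∀ c p → parent c ≡ just p → ∣ cover c ∣ ≤ ∣ cover p ∣
  where open EHD D
        open Tree tree

module Submission where

-- Monotonicity: recompute the covers
-- bottom-up, padding cover(t) with blue nodes from the children's new covers
-- until it is as large as the largest of them (so sizes stay ≤ k), and take the
-- new bags to be the neighbourhoods of the new covers.  A padded node e of the
-- new cover(t) comes from a descendant s with e ∈ cover(s), and every new cover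
-- on the path from t to s contains e, so the connectivity conditions survive.
-- Binarity: replace every node p by a path (p,0), (p,1), …, (p,n) carrying the
-- bag and cover of p, and hang the path of each child c of p below (p,c+1).
-- Cover sizes are constant along these paths, so monotonicity is preserved.

open import Defs
open import Data.Bool using (Bool; true; false; T)
open import Data.Bool.Properties using (T-≡) renaming (_≟_ to _≟ᵇ_)
open import Data.Fin using (Fin; zero; suc; toℕ; inject₁; combine; remQuot)
import Data.Fin.Properties as Finₚ
open import Data.Fin.Subset using (Subset; _∈_; ∣_∣)
open import Data.Fin.Subset.Properties using (_∈?_; p⊆q⇒∣p∣≤∣q∣)
open import Data.List using (List; []; _∷_; allFin; filter)
open import Data.List.Extrema.Nat using (argmax; f[xs]≤f[argmax])
open import Data.List.Membership.Propositional using () renaming (_∈_ to _∈ₗ_)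
open import Data.List.Membership.Propositional.Properties using (∈-allFin; ∈-filter⁺; ∈-filter⁻)
import Data.List.Relation.Unary.All as All
open import Data.List.Relation.Unary.Any using (here; there)
open import Data.Maybe as Maybe using (Maybe; just; nothing; maybe)
open import Data.Maybe.Properties using (just-injective) renaming (≡-dec to ≡-decMaybe)
open import Data.Nat using (ℕ; zero; suc; _+_; _∸_; _*_; _≤_; _⊔_; z≤n; s≤s)
open import Data.Nat.Properties
open import Data.Product using (Σ; _×_; _,_; ∃-syntax; proj₁; proj₂)
open import Data.Sum as Sum using (_⊎_; inj₁; inj₂)
open import Data.Vec using ([]; _∷_; tabulate; here; there)
open import Data.Vec.Properties using (lookup∘tabulate; []=⇒lookup; lookup⇒[]=)
open import Function using (_∘_)
open import Function.Bundles using (_⇔_; mk⇔; Equivalence)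
open import Relation.Binary.PropositionalEquality
open import Relation.Nullary.Decidable using (Dec; isYes; toWitness; fromWitness; _×-dec_)

open Equivalence using (to; from)

m+[n∸m]≡m⊔n : ∀ m n → m + (n ∸ m) ≡ m ⊔ n
m+[n∸m]≡m⊔n zero    n       = refl
m+[n∸m]≡m⊔n (suc m) zero    = cong suc (+-identityʳ m)
m+[n∸m]≡m⊔n (suc m) (suc n) = cong suc (m+[n∸m]≡m⊔n m n)

m∸n≡1+[m∸1+n] : ∀ {m n} → suc n ≤ m → m ∸ n ≡ suc (m ∸ suc n)
m∸n≡1+[m∸1+n] {suc m} {zero}  _         = refl
m∸n≡1+[m∸1+n] {suc m} {suc n} (s≤s n<m) = m∸n≡1+[m∸1+n] n<m

extendBy : ∀ {m} → ℕ → Subset m → Subset m → Subset m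
extendBy s       []           []           = []
extendBy s       (true ∷ A)   (_ ∷ B)      = true ∷ extendBy s A B
extendBy zero    (false ∷ A)  (_ ∷ B)      = false ∷ extendBy zero A B
extendBy (suc s) (false ∷ A)  (true ∷ B)   = true ∷ extendBy s A B
extendBy (suc s) (false ∷ A)  (false ∷ B)  = false ∷ extendBy (suc s) A B

extendBy-⊇ : ∀ {m} s (A B : Subset m) {x} → x ∈ A → x ∈ extendBy s A B
extendBy-⊇ s       (true ∷ A)  (_ ∷ B)     here      = here
extendBy-⊇ s       (true ∷ A)  (_ ∷ B)     (there p) = there (extendBy-⊇ s A B p)
extendBy-⊇ zero    (false ∷ A) (_ ∷ B)     (there p) = there (extendBy-⊇ zero A B p)
extendBy-⊇ (suc s) (false ∷ A) (true ∷ B)  (there p) = there (extendBy-⊇ s A B p)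
extendBy-⊇ (suc s) (false ∷ A) (false ∷ B) (there p) = there (extendBy-⊇ (suc s) A B p)

extendBy-⊆ : ∀ {m} s (A B : Subset m) {x} → x ∈ extendBy s A B → x ∈ A ⊎ x ∈ B
extendBy-⊆ s       (true ∷ A)  (_ ∷ B)     here      = inj₁ here
extendBy-⊆ (suc s) (false ∷ A) (true ∷ B)  here      = inj₂ here
extendBy-⊆ s       (true ∷ A)  (_ ∷ B)     (there p) = Sum.map there there (extendBy-⊆ s A B p)
extendBy-⊆ zero    (false ∷ A) (_ ∷ B)     (there p) = Sum.map there there (extendBy-⊆ zero A B p)
extendBy-⊆ (suc s) (false ∷ A) (true ∷ B)  (there p) = Sum.map there there (extendBy-⊆ s A B p)
extendBy-⊆ (suc s) (false ∷ A) (false ∷ B) (there p) = Sum.map there there (extendBy-⊆ (suc s) A B p)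

∣extendBy∣≤ : ∀ {m} s (A B : Subset m) → ∣ extendBy s A B ∣ ≤ ∣ A ∣ + s
∣extendBy∣≤ s       []          []          = z≤n
∣extendBy∣≤ s       (true ∷ A)  (_ ∷ B)     = s≤s (∣extendBy∣≤ s A B)
∣extendBy∣≤ zero    (false ∷ A) (_ ∷ B)     = ∣extendBy∣≤ zero A B
∣extendBy∣≤ (suc s) (false ∷ A) (true ∷ B)  =
  ≤-trans (s≤s (∣extendBy∣≤ s A B)) (≤-reflexive (sym (+-suc ∣ A ∣ s)))
∣extendBy∣≤ (suc s) (false ∷ A) (false ∷ B) = ∣extendBy∣≤ (suc s) A B

∣extendBy∣≥ : ∀ {m} s (A B : Subset m) →
              (∣ A ∣ + s ≤ ∣ extendBy s A B ∣) ⊎ (∣ B ∣ ≤ ∣ extendBy s A B ∣)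
∣extendBy∣≥ s       []          []          = inj₂ z≤n
∣extendBy∣≥ s       (true ∷ A)  (b ∷ B)     with ∣extendBy∣≥ s A B
... | inj₁ le = inj₁ (s≤s le)
... | inj₂ le = inj₂ (≤-trans (∣b∷B∣≤1+∣B∣ b B) (s≤s le))
  where
  ∣b∷B∣≤1+∣B∣ : ∀ {m} b (B : Subset m) → ∣ b ∷ B ∣ ≤ suc ∣ B ∣
  ∣b∷B∣≤1+∣B∣ true  B = ≤-refl
  ∣b∷B∣≤1+∣B∣ false B = n≤1+n ∣ B ∣
∣extendBy∣≥ zero    (false ∷ A) (_ ∷ B)     =
  inj₁ (≤-trans (≤-reflexive (+-identityʳ ∣ A ∣)) (p⊆q⇒∣p∣≤∣q∣ (extendBy-⊇ zero A B)))
∣extendBy∣≥ (suc s) (false ∷ A) (true ∷ B)  with ∣extendBy∣≥ s A B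
... | inj₁ le = inj₁ (≤-trans (≤-reflexive (+-suc ∣ A ∣ s)) (s≤s le))
... | inj₂ le = inj₂ (s≤s le)
∣extendBy∣≥ (suc s) (false ∷ A) (false ∷ B) = ∣extendBy∣≥ (suc s) A B

padWith : ∀ {m} → Subset m → Subset m → Subset m
padWith A B = extendBy (∣ B ∣ ∸ ∣ A ∣) A B

∣padWith∣ : ∀ {m} (A B : Subset m) → ∣ padWith A B ∣ ≡ ∣ A ∣ ⊔ ∣ B ∣
∣padWith∣ A B = ≤-antisym upper (⊔-lub (p⊆q⇒∣p∣≤∣q∣ (extendBy-⊇ _ A B)) lowerB)
  where
  upper : ∣ padWith A B ∣ ≤ ∣ A ∣ ⊔ ∣ B ∣
  upper = ≤-trans (∣extendBy∣≤ _ A B) (≤-reflexive (m+[n∸m]≡m⊔n ∣ A ∣ ∣ B ∣))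
  lowerB : ∣ B ∣ ≤ ∣ padWith A B ∣
  lowerB with ∣extendBy∣≥ (∣ B ∣ ∸ ∣ A ∣) A B
  ... | inj₁ le = ≤-trans (m≤n+m∸n ∣ B ∣ ∣ A ∣) le
  ... | inj₂ le = le

padAll : ∀ {m} {X : Set} → Subset m → (X → Subset m) → List X → Subset m
padAll A g []       = A
padAll A g (c ∷ cs) = padWith (padAll A g cs) (g c)

module _ {m} {X : Set} {A : Subset m} {g : X → Subset m} where

  padAll-⊇ : ∀ cs {x} → x ∈ A → x ∈ padAll A g cs
  padAll-⊇ []       x∈A = x∈A
  padAll-⊇ (c ∷ cs) x∈A = extendBy-⊇ _ _ (g c) (padAll-⊇ cs x∈A)

  padAll-⊆ : ∀ cs {x} → x ∈ padAll A g cs → x ∈ A ⊎ ∃[ c ] (c ∈ₗ cs × x ∈ g c)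
  padAll-⊆ []       x∈ = inj₁ x∈
  padAll-⊆ (c ∷ cs) x∈ with extendBy-⊆ _ (padAll A g cs) (g c) x∈
  ... | inj₂ x∈gc = inj₂ (c , here refl , x∈gc)
  ... | inj₁ x∈rest with padAll-⊆ cs x∈rest
  ...   | inj₁ x∈A               = inj₁ x∈A
  ...   | inj₂ (c′ , c′∈cs , x∈) = inj₂ (c′ , there c′∈cs , x∈)

  ∣padAll∣≤ : ∀ {k} cs → ∣ A ∣ ≤ k → (∀ c → ∣ g c ∣ ≤ k) → ∣ padAll A g cs ∣ ≤ k
  ∣padAll∣≤ []       ∣A∣≤k _     = ∣A∣≤k
  ∣padAll∣≤ {k} (c ∷ cs) ∣A∣≤k ∣g∣≤k = begin
    ∣ padWith (padAll A g cs) (g c) ∣ ≡⟨ ∣padWith∣ (padAll A g cs) (g c) ⟩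
    ∣ padAll A g cs ∣ ⊔ ∣ g c ∣       ≤⟨ ⊔-lub (∣padAll∣≤ cs ∣A∣≤k ∣g∣≤k) (∣g∣≤k c) ⟩
    k                                 ∎
    where open ≤-Reasoning

  ∣g∣≤∣padAll∣ : ∀ {c} cs → c ∈ₗ cs → ∣ g c ∣ ≤ ∣ padAll A g cs ∣
  ∣g∣≤∣padAll∣ (c ∷ cs) c′∈ = subst (_ ≤_) (sym (∣padWith∣ (padAll A g cs) (g c))) (≤⊔ c′∈)
    where
    ≤⊔ : ∀ {c′} → c′ ∈ₗ c ∷ cs → ∣ g c′ ∣ ≤ ∣ padAll A g cs ∣ ⊔ ∣ g c ∣
    ≤⊔ (here refl)    = m≤n⊔m _ _
    ≤⊔ (there c′∈cs) = ≤-trans (∣g∣≤∣padAll∣ cs c′∈cs) (m≤m⊔n _ _)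

∈-tabulate : ∀ {m} (f : Fin m → Bool) x → (x ∈ tabulate f) ⇔ T (f x)
∈-tabulate f x = mk⇔
  (λ x∈ → from T-≡ (trans (sym (lookup∘tabulate f x)) ([]=⇒lookup x∈)))
  (λ fx → lookup⇒[]= x (tabulate f) (trans (lookup∘tabulate f x) (to T-≡ fx)))

module _ (I : IncGraph) where
  open IncGraph I

  neighbourhood : Subset nB → Subset nR
  neighbourhood C = tabulate (λ v → isYes (Finₚ.any? (λ e → (e ∈? C) ×-dec (adj e v ≟ᵇ true))))

  ∈-neighbourhood : ∀ {C v} → v ∈ neighbourhood C ⇔ (∃[ e ] (e ∈ C × N I e v))
  ∈-neighbourhood {C} {v} =
    mk⇔ (toWitness ∘ to (∈-tabulate _ v)) (from (∈-tabulate _ v) ∘ fromWitness)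

module Walk (T : Tree) where
  open Tree T

  private variable
    S S′ : Fin n → Set
    t u v : Fin n

  Edge-sym : Edge T t u → Edge T u t
  Edge-sym = Sum.swap

  start : WalkIn T S t u → S t
  start (here s)     = s
  start (step s _ _) = s

  _++_ : WalkIn T S t u → WalkIn T S u v → WalkIn T S t v
  here _     ++ w′ = w′
  step s e w ++ w′ = step s e (w ++ w′)

  reverse : WalkIn T S t u → WalkIn T S u t
  reverse (here s)     = here s
  reverse (step s e w) = reverse w ++ step (start w) (Edge-sym e) (here s)

  mono : (∀ x → S x → S′ x) → WalkIn T S t u → WalkIn T S′ t u
  mono f (here s)     = here (f _ s)
  mono f (step s e w) = step (f _ s) e (mono f w)

  connected-from : (∀ x → S x → S′ x) → Connected T S →
                   (∀ x → S′ x → ∃[ s ] (S s × WalkIn T S′ x s)) → Connected T S′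
  connected-from S⊆S′ S-conn reach t u t∈ u∈ with reach t t∈ | reach u u∈
  ... | s , s∈ , w | s′ , s′∈ , w′ = w ++ (mono S⊆S′ (S-conn s s′ s∈ s′∈) ++ reverse w′)

module Monotonize {I : IncGraph} (D : EHD I) where
  open IncGraph I
  open EHD D
  open Tree tree
  open Walk tree

  child? : ∀ t c → Dec (parent c ≡ just t)
  child? t c = ≡-decMaybe Finₚ._≟_ (parent c) (just t)

  children : Fin n → List (Fin n)
  children t = filter (child? t) (allFin n)

  ∈-children⁺ : ∀ {c t} → parent c ≡ just t → c ∈ₗ children t
  ∈-children⁺ {c} {t} = ∈-filter⁺ (child? t) (∈-allFin c)

  ∈-children⁻ : ∀ {c t} → c ∈ₗ children t → parent c ≡ just t
  ∈-children⁻ {c} {t} = proj₂ ∘ ∈-filter⁻ (child? t) {xs = allFin n}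

  raise : ℕ → Fin n → Subset nB
  raise zero    t = cover t
  raise (suc f) t = padAll (cover t) (raise f) (children t)

  height : ℕ
  height = depth (argmax depth root (allFin n))

  depth≤height : ∀ t → depth t ≤ height
  depth≤height t = All.lookup (f[xs]≤f[argmax] root (allFin n)) (∈-allFin t)

  fuel : Fin n → ℕ
  fuel t = height ∸ depth t

  fuel-parent : ∀ {c t} → parent c ≡ just t → fuel t ≡ suc (fuel c)
  fuel-parent {c} {t} c→t =
    trans (m∸n≡1+[m∸1+n] (≤-trans (≤-reflexive (sym c-deeper)) (depth≤height c)))
          (cong (λ d → suc (height ∸ d)) (sym c-deeper))
    where
    c-deeper : depth c ≡ suc (depth t)
    c-deeper = depth-parent c t c→t

  -- By fuel-parent, the children of t are raised with exactly one unit of fuel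
  -- less than t, so this is a bottom-up recursion over the tree.
  cover′ : Fin n → Subset nB
  cover′ t = raise (fuel t) t

  cover⊆cover′ : ∀ t {e} → e ∈ cover t → e ∈ cover′ t
  cover⊆cover′ t = raise-⊇ (fuel t)
    where
    raise-⊇ : ∀ f {e} → e ∈ cover t → e ∈ raise f t
    raise-⊇ zero    e∈ = e∈
    raise-⊇ (suc f) e∈ = padAll-⊇ (children t) e∈

  trace : ∀ {e} f t → f ≡ fuel t → e ∈ raise f t →
          ∃[ s ] (e ∈ cover s × WalkIn tree (λ x → e ∈ cover′ x) t s)
  trace {e} zero t f≡ e∈ = t , e∈ , here (subst (λ f → e ∈ raise f t) f≡ e∈)
  trace {e} (suc f) t f≡ e∈ with padAll-⊆ (children t) e∈
  ... | inj₁ e∈cover = t , e∈cover , here (subst (λ f → e ∈ raise f t) f≡ e∈)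
  ... | inj₂ (c , c∈ , e∈c) with ∈-children⁻ c∈
  ...   | c→t with trace f c (suc-injective (trans f≡ (fuel-parent c→t))) e∈c
  ...     | s , e∈s , w = s , e∈s , step (subst (λ f → e ∈ raise f t) f≡ e∈) (inj₂ c→t) w

  bag′ : Fin n → Subset nR
  bag′ t = neighbourhood I (cover′ t)

  bag⊆bag′ : ∀ t {v} → v ∈ bag t → v ∈ bag′ t
  bag⊆bag′ t {v} v∈ with to (bagIsUnion t v) v∈
  ... | e , e∈ , ev = from (∈-neighbourhood I) (e , cover⊆cover′ t e∈ , ev)

  cover′-connected : ∀ e → Connected tree (λ t → e ∈ cover′ t)
  cover′-connected e =
    connected-from (λ t → cover⊆cover′ t) (coverConnected e) (λ t → trace (fuel t) t refl)

  bag′-connected : ∀ v → Connected tree (λ t → v ∈ bag′ t)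
  bag′-connected v = connected-from (λ t → bag⊆bag′ t) (bagConnected v) reach
    where
    reach : ∀ t → v ∈ bag′ t → ∃[ s ] (v ∈ bag s × WalkIn tree (λ x → v ∈ bag′ x) t s)
    reach t v∈ with to (∈-neighbourhood I) v∈
    ... | e , e∈ , ev with trace (fuel t) t refl e∈
    ...   | s , e∈s , w = s , from (bagIsUnion s v) (e , e∈s , ev)
                            , mono (λ x e∈x → from (∈-neighbourhood I) (e , e∈x , ev)) w

  monotonize : EHD I
  monotonize = record
    { tree           = tree
    ; bag            = bag′
    ; cover          = cover′
    ; covers         = λ e → let (t , N⊆ , e∈) = covers e in
                         t , (λ v ev → bag⊆bag′ t (N⊆ v ev)) , cover⊆cover′ t e∈
    ; bagConnected   = bag′-connected
    ; coverConnected = cover′-connected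
    ; bagIsUnion     = λ t v → ∈-neighbourhood I
    }

  monotonize-width : ∀ {k} → WidthAtMost D k → WidthAtMost monotonize k
  monotonize-width {k} width≤k t = ∣raise∣≤ (fuel t) t
    where
    ∣raise∣≤ : ∀ f t → ∣ raise f t ∣ ≤ k
    ∣raise∣≤ zero    t = width≤k t
    ∣raise∣≤ (suc f) t = ∣padAll∣≤ (children t) (width≤k t) (∣raise∣≤ f)

  monotonize-monotone : Monotone monotonize
  monotonize-monotone c t c→t =
    subst (λ f → ∣ cover′ c ∣ ≤ ∣ raise f t ∣) (sym (fuel-parent c→t))
          (∣g∣≤∣padAll∣ (children t) (∈-children⁺ c→t))

bool-pigeonhole : ∀ (a b c : Bool) → a ≡ b ⊎ a ≡ c ⊎ b ≡ c
bool-pigeonhole true  true  _     = inj₁ refl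
bool-pigeonhole false false _     = inj₁ refl
bool-pigeonhole true  false true  = inj₂ (inj₁ refl)
bool-pigeonhole false true  false = inj₂ (inj₁ refl)
bool-pigeonhole true  false false = inj₂ (inj₂ refl)
bool-pigeonhole false true  true  = inj₂ (inj₂ refl)

module Binarize (T : Tree) where
  open Tree T

  -- (p , 0) stands for p itself, (p , j+1) is the j-th node of the path below it.
  Node : Set
  Node = Fin n × Fin (suc n)

  up : Node → Maybe Node
  up (t , zero)  = Maybe.map (λ p → p , suc t) (parent t)
  up (p , suc j) = just (p , inject₁ j)

  isMain : Node → Bool
  isMain (_ , zero)  = true
  isMain (_ , suc _) = false

  up-main : ∀ c {x} → up (c , zero) ≡ just x → proj₂ x ≡ suc c
  up-main c eq with parent c
  ... | just p = cong proj₂ (sym (just-injective eq))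

  up-injective : ∀ {y₁ y₂ x} → isMain y₁ ≡ isMain y₂ →
                 up y₁ ≡ just x → up y₂ ≡ just x → y₁ ≡ y₂
  up-injective {c₁ , zero} {c₂ , zero} _ e₁ e₂ =
    cong (_, zero) (Finₚ.suc-injective (trans (sym (up-main c₁ e₁)) (up-main c₂ e₂)))
  up-injective {p₁ , suc j₁} {p₂ , suc j₂} _ e₁ e₂ =
    cong₂ (λ p j → p , suc j) (cong proj₁ same) (Finₚ.inject₁-injective (cong proj₂ same))
    where
    same : (p₁ , inject₁ j₁) ≡ (p₂ , inject₁ j₂)
    same = just-injective (trans e₁ (sym e₂))

  up-binary : ∀ {x y₁ y₂ y₃} → up y₁ ≡ just x → up y₂ ≡ just x → up y₃ ≡ just x →
              y₁ ≡ y₂ ⊎ y₁ ≡ y₃ ⊎ y₂ ≡ y₃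
  up-binary {y₁ = y₁} {y₂} {y₃} e₁ e₂ e₃
    with bool-pigeonhole (isMain y₁) (isMain y₂) (isMain y₃)
  ... | inj₁ same        = inj₁ (up-injective same e₁ e₂)
  ... | inj₂ (inj₁ same) = inj₂ (inj₁ (up-injective same e₁ e₃))
  ... | inj₂ (inj₂ same) = inj₂ (inj₂ (up-injective same e₂ e₃))

  up-proj : ∀ y {x} → up y ≡ just x →
            proj₁ y ≡ proj₁ x ⊎ parent (proj₁ y) ≡ just (proj₁ x)
  up-proj (c , zero) eq with parent c
  ... | just p = inj₂ (cong (just ∘ proj₁) (just-injective eq))
  up-proj (p , suc j) refl = inj₁ refl

  weightToRoot : ℕ → Fin n → ℕ
  weightToRoot zero    t = 0
  weightToRoot (suc f) t = maybe (λ p → weightToRoot f p + suc (suc (toℕ t))) 0 (parent t)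

  mainDepth : Fin n → ℕ
  mainDepth t = weightToRoot (depth t) t

  mainDepth-parent : ∀ {t p} → parent t ≡ just p → mainDepth t ≡ mainDepth p + suc (suc (toℕ t))
  mainDepth-parent {t} {p} t→p rewrite depth-parent t p t→p | t→p = refl

  nodeDepth : Node → ℕ
  nodeDepth (p , i) = mainDepth p + toℕ i

  nodeDepth-up : ∀ y {x} → up y ≡ just x → nodeDepth y ≡ suc (nodeDepth x)
  nodeDepth-up (t , zero) eq with parent t in t→p
  nodeDepth-up (t , zero) refl | just p = begin
    mainDepth t + 0                 ≡⟨ +-identityʳ _ ⟩
    mainDepth t                     ≡⟨ mainDepth-parent t→p ⟩
    mainDepth p + suc (suc (toℕ t)) ≡⟨ +-suc (mainDepth p) _ ⟩
    suc (mainDepth p + suc (toℕ t)) ∎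
    where open ≡-Reasoning
  nodeDepth-up (p , suc j) refl =
    trans (+-suc (mainDepth p) (toℕ j))
          (cong (λ i → suc (mainDepth p + i)) (sym (Finₚ.toℕ-inject₁ j)))

  up≡nothing : ∀ y → up y ≡ nothing → y ≡ (root , zero)
  up≡nothing (t , zero) eq with parent t in no-parent
  ... | nothing = cong (_, zero) (no-parent⇒root t no-parent)

  encode : Node → Fin (n * suc n)
  encode (p , i) = combine p i

  decode : Fin (n * suc n) → Node
  decode = remQuot (suc n)

  decode-encode : ∀ y → decode (encode y) ≡ y
  decode-encode (p , i) = Finₚ.remQuot-combine p i

  encode-decode : ∀ i → encode (decode i) ≡ i
  encode-decode = Finₚ.combine-remQuot {n} (suc n)

  decode-injective : ∀ {i j} → decode i ≡ decode j → i ≡ j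
  decode-injective {i} {j} eq =
    trans (sym (encode-decode i)) (trans (cong encode eq) (encode-decode j))

  parentᴮ : Fin (n * suc n) → Maybe (Fin (n * suc n))
  parentᴮ i = Maybe.map encode (up (decode i))

  parentᴮ-decode : ∀ i {j} → parentᴮ i ≡ just j → up (decode i) ≡ just (decode j)
  parentᴮ-decode i eq with up (decode i)
  parentᴮ-decode i refl | just x = cong just (sym (decode-encode x))

  parentᴮ-encode : ∀ {y x} → up y ≡ just x → parentᴮ (encode y) ≡ just (encode x)
  parentᴮ-encode {y} eq rewrite decode-encode y | eq = refl

  binarize : Tree
  binarize = record
    { n              = n * suc n
    ; root           = encode (root , zero)
    ; parent         = parentᴮ
    ; depth          = nodeDepth ∘ decode
    ; root-parent    = root-parentᴮ
    ; no-parent⇒root = no-parentᴮ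
    ; depth-parent   = λ i j eq → nodeDepth-up (decode i) (parentᴮ-decode i eq)
    }
    where
    root-parentᴮ : parentᴮ (encode (root , zero)) ≡ nothing
    root-parentᴮ rewrite decode-encode (root , zero) | root-parent = refl
    no-parentᴮ : ∀ i → parentᴮ i ≡ nothing → i ≡ encode (root , zero)
    no-parentᴮ i eq with up (decode i) in up≡
    ... | nothing = trans (sym (encode-decode i)) (cong encode (up≡nothing (decode i) up≡))

  proj : Fin (n * suc n) → Fin n
  proj = proj₁ ∘ decode

  binarize-binary : Binary binarize
  binarize-binary _ c₁ c₂ c₃ e₁ e₂ e₃ =
    Sum.map decode-injective (Sum.map decode-injective decode-injective)
      (up-binary (parentᴮ-decode c₁ e₁) (parentᴮ-decode c₂ e₂) (parentᴮ-decode c₃ e₃))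

  proj-parent : ∀ c {p} → parentᴮ c ≡ just p →
                proj c ≡ proj p ⊎ parent (proj c) ≡ just (proj p)
  proj-parent c eq = up-proj (decode c) (parentᴮ-decode c eq)

  open Walk binarize using (_++_; reverse)

  module _ (S : Fin n → Set) where

    S∘proj : Fin (n * suc n) → Set
    S∘proj = S ∘ proj

    lift : ∀ {p} a → S p → S∘proj (encode (p , a))
    lift {p} a s = subst S (sym (cong proj₁ (decode-encode (p , a)))) s

    down-path : ∀ m {p} (a : Fin (suc n)) → toℕ a ≡ m → S p →
                WalkIn binarize S∘proj (encode (p , a)) (encode (p , zero))
    down-path m       zero    _ s = here (lift zero s)
    down-path (suc m) (suc j) a≡ s =
      step (lift (suc j) s) (inj₁ (parentᴮ-encode refl))
           (down-path m (inject₁ j) (trans (Finₚ.toℕ-inject₁ j) (suc-injective a≡)) s)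

    child-path : ∀ {t p} → parent t ≡ just p → S t → S p →
                 WalkIn binarize S∘proj (encode (t , zero)) (encode (p , zero))
    child-path {t} t→p st sp =
      step (lift zero st) (inj₁ (parentᴮ-encode (cong (Maybe.map (λ q → q , suc t)) t→p)))
           (down-path (suc (toℕ t)) (suc t) refl sp)

    lift-walk : ∀ {t u} → WalkIn T S t u →
                WalkIn binarize S∘proj (encode (t , zero)) (encode (u , zero))
    lift-walk (here s)              = here (lift zero s)
    lift-walk (step s (inj₁ t→u) w) = child-path t→u s (Walk.start T w) ++ lift-walk w
    lift-walk (step s (inj₂ u→t) w) = reverse (child-path u→t (Walk.start T w) s) ++ lift-walk w

    binarize-connected : Connected T S → Connected binarize S∘proj
    binarize-connected S-conn i j si sj =
      subst₂ (WalkIn binarize S∘proj) (encode-decode i) (encode-decode j)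
        (down-path _ (proj₂ (decode i)) refl si
         ++ (lift-walk (S-conn _ _ si sj) ++ reverse (down-path _ (proj₂ (decode j)) refl sj)))

module BinarizeEHD {I : IncGraph} (D : EHD I) where
  open EHD D
  open Tree tree
  open Binarize tree

  binarizeEHD : EHD I
  binarizeEHD = record
    { tree           = binarize
    ; bag            = bag ∘ proj
    ; cover          = cover ∘ proj
    ; covers         = λ e → let (t , N⊆ , e∈) = covers e in
                         encode (t , zero)
                         , (λ v ev → lift (λ t → v ∈ bag t) zero (N⊆ v ev))
                         , lift (λ t → e ∈ cover t) zero e∈
    ; bagConnected   = λ v → binarize-connected (λ t → v ∈ bag t) (bagConnected v)
    ; coverConnected = λ e → binarize-connected (λ t → e ∈ cover t) (coverConnected e)
    ; bagIsUnion     = bagIsUnion ∘ proj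
    }

  binarize-width : ∀ {k} → WidthAtMost D k → WidthAtMost binarizeEHD k
  binarize-width width≤k = width≤k ∘ proj

  binarize-monotone : Monotone D → Monotone binarizeEHD
  binarize-monotone monotone c p c→p with proj-parent c c→p
  ... | inj₁ same  = ≤-reflexive (cong (∣_∣ ∘ cover) same)
  ... | inj₂ pc→pp = monotone (proj c) (proj p) pc→pp

open Monotonize using (monotonize; monotonize-width; monotonize-monotone)
open Binarize using (binarize-binary)
open BinarizeEHD using (binarizeEHD; binarize-width; binarize-monotone)

lemma9 : (k : ℕ) → 1 ≤ k → (I : IncGraph) → EhwAtMost I k →
    Σ (EHD I) (λ D →
      (∣ EHD.cover D (Tree.root (EHD.tree D)) ∣ ≤ k)
      × Binary (EHD.tree D)
      × Monotone D)
lemma9 k _ I (D , width≤k) =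
  binarizeEHD D′ ,
  binarize-width D′ (monotonize-width D width≤k) _ ,
  binarize-binary (EHD.tree D′) ,
  binarize-monotone D′ (monotonize-monotone D)
  where
  D′ : EHD I
  D′ = monotonize D
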